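{- Let $G$ be an $r$-regular graph with $r>1$. If the line graph $L(G)$ is closed distance magic, then $1-r\in Sp(G)$.
   Context: $Sp(G)$ denotes the set of eigenvalues of the adjacency matrix of $G$. $L(G)$ is the line graph of $G$. A graph on $n$ vertices is closed distance magic if there is a bijection $\ell\colon V\to\{1,\dots,n\}$ and a positive integer $k'$ such that the sum of $\ell$ over the closed neighborhood $N[x]$ ($x$ and its neighbors) of every vertex $x$ equals $k'$. -}

module Defs where

open import Data.Nat using (ℕ; zero; suc; _+_; _<_)
open import Data.Integer as ℤ using (ℤ)
open import Data.Fin using (Fin; zero; suc; toℕ; _≟_)
open import Data.Bool using (Bool; true; false; if_then_else_; _∧_; _∨_; not)
open import Data.Product using (Σ; ∃; _×_; _,_; proj₁; proj₂)
open import Relation.Binary.PropositionalEquality using (_≡_; refl; sym)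
open import Relation.Nullary using (¬_; does)
open import Relation.Nullary.Decidable using (dec-true; dec-false)
open import Function.Bundles using (_↔_; Inverse)

Σℕ : (n : ℕ) → (Fin n → ℕ) → ℕ
Σℕ zero    f = 0
Σℕ (suc n) f = f zero + Σℕ n (λ i → f (suc i))

Σℤ : (n : ℕ) → (Fin n → ℤ) → ℤ
Σℤ zero    f = ℤ.0ℤ
Σℤ (suc n) f = f zero ℤ.+ Σℤ n (λ i → f (suc i))

record Graph (n : ℕ) : Set where
  field
    adj    : Fin n → Fin n → Bool
    symm   : ∀ i j → adj i j ≡ adj j i
    irrefl : ∀ i → adj i i ≡ false
open Graph public

degree : ∀ {n} → Graph n → Fin n → ℕ
degree {n} G i = Σℕ n (λ j → if adj G i j then 1 else 0)

Regular : ∀ {n} → Graph n → ℕ → Set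
Regular G r = ∀ i → degree G i ≡ r

-- λ ∈ Sp(G) for an integer λ: A x = λ x for some nonzero vector x
-- (integer entries; for an integer matrix and integer λ this is the same
-- as having a nonzero real eigenvector).
IsEigenvalue : ∀ {n} → Graph n → ℤ → Set
IsEigenvalue {n} G λ′ =
  Σ (Fin n → ℤ) λ x →
    (∃ λ i → ¬ (x i ≡ ℤ.0ℤ)) ×
    (∀ i → Σℤ n (λ j → if adj G i j then x j else ℤ.0ℤ) ≡ λ′ ℤ.* x i)

-- Closed distance magic: bijection ℓ : V → {1..n} (ℓ x = toℕ (π x) + 1)
-- and k' > 0 with Σ_{y ∈ N[x]} ℓ y = k' for all x.
ClosedDistanceMagic : ∀ {n} → Graph n → Set
ClosedDistanceMagic {n} G =
  Σ (Fin n ↔ Fin n) λ π → Σ ℕ λ k′ → (0 < k′) ×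
    (∀ x → Σℕ n (λ y → if does (x ≟ y) ∨ adj G x y
                         then suc (toℕ (Inverse.to π y)) else 0) ≡ k′)

Edge : ∀ {n} → Graph n → Set
Edge {n} G = Σ (Fin n × Fin n) λ p →
  (toℕ (proj₁ p) < toℕ (proj₂ p)) × (adj G (proj₁ p) (proj₂ p) ≡ true)

_==_ : ∀ {n} → Fin n → Fin n → Bool
a == b = does (a ≟ b)

==-sym : ∀ {n} (a b : Fin n) → (a == b) ≡ (b == a)
==-sym a b with a ≟ b | b ≟ a
... | Relation.Nullary.yes _ | Relation.Nullary.yes _ = refl
... | Relation.Nullary.no _  | Relation.Nullary.no _  = refl
... | Relation.Nullary.yes p | Relation.Nullary.no q  = Data.Empty.⊥-elim (q (sym p))
  where import Data.Empty
... | Relation.Nullary.no q  | Relation.Nullary.yes p = Data.Empty.⊥-elim (q (sym p))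
  where import Data.Empty

==-refl : ∀ {n} (a : Fin n) → (a == a) ≡ true
==-refl a = dec-true (a ≟ a) refl

lineAdj : ∀ {n} (G : Graph n) → Edge G → Edge G → Bool
lineAdj G ((u , v) , _) ((u′ , v′) , _) =
  ((u == u′) ∨ (u == v′) ∨ (v == u′) ∨ (v == v′)) ∧ not ((u == u′) ∧ (v == v′))

private
  ∨-comm : ∀ a b → (a ∨ b) ≡ (b ∨ a)
  ∨-comm false false = refl
  ∨-comm false true  = refl
  ∨-comm true  false = refl
  ∨-comm true  true  = refl

  shuffle : ∀ a b c d → (a ∨ b ∨ c ∨ d) ≡ (a ∨ c ∨ b ∨ d)
  shuffle true  b c d = refl
  shuffle false true  true  d = refl
  shuffle false true  false d = refl
  shuffle false false true  d = refl
  shuffle false false false d = refl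

lineAdj-sym : ∀ {n} (G : Graph n) (e f : Edge G) → lineAdj G e f ≡ lineAdj G f e
lineAdj-sym G ((u , v) , _) ((u′ , v′) , _)
  rewrite ==-sym u u′ | ==-sym u v′ | ==-sym v u′ | ==-sym v v′
        | shuffle (u′ == u) (v′ == u) (u′ == v) (v′ == v) = refl

lineAdj-irrefl : ∀ {n} (G : Graph n) (e : Edge G) → lineAdj G e e ≡ false
lineAdj-irrefl G ((u , v) , _) rewrite ==-refl u | ==-refl v = refl

LineGraph : ∀ {n} (G : Graph n) (m : ℕ) → Fin m ↔ Edge G → Graph m
LineGraph G m enum = record
  { adj    = λ i j → lineAdj G (to i) (to j)
  ; symm   = λ i j → lineAdj-sym G (to i) (to j)
  ; irrefl = λ i → lineAdj-irrefl G (to i)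
  }
  where open Inverse enum

module Submission where

-- Label the edges by L and let s(u) be the sum of the labels of the edges at u.  In L(G) the
-- closed neighbourhood of the edge ab consists of the edges at a and the edges at b, with ab
-- itself counted twice, so a closed distance magic labelling with constant k satisfies
-- s(a) + s(b) = k + L(ab).  Summing over the r edges at u gives A s + r s = s + r k 𝟙, and
-- since A 𝟙 = r 𝟙 the vector x = (2r − 1) s − r k 𝟙 satisfies A x = (1 − r) x.  If x were 0,
-- s would be constant, hence so would L, which is impossible for an injective labelling of
-- m ≥ r ≥ 2 edges.

open import Defs
open import Data.Nat using (ℕ; _<_)
open import Data.Integer using (+_; _-_)
open import Data.Fin using (Fin)
open import Function.Bundles using (_↔_)

open import Axiom.UniquenessOfIdentityProofs using (module Decidable⇒UIP)
import Data.Bool.Properties as Bool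
open import Data.Bool using (Bool; true; false; if_then_else_; _∧_; _∨_; not)
open import Data.Empty using (⊥-elim)
open import Data.Fin using (zero; suc; toℕ; _≟_; fromℕ<)
open import Data.Fin.Properties using (<-cmp; ¬∀⟶∃¬; toℕ-injective)
open import Data.Integer as ℤ using (ℤ; 0ℤ)
import Data.Integer.Properties as ℤ
open import Data.Integer.Tactic.RingSolver using () renaming (solve-∀ to ℤ-solve-∀)
open import Data.Nat using (zero; suc; _+_; _*_; _≤_; z≤n; s≤s; z<s)
open import Data.Nat.Properties hiding (_≟_; <-cmp)
open import Data.Nat.Tactic.RingSolver using (solve-∀)
open import Algebra.Properties.Semiring.Sum +-*-semiring
  using (sum; sum-syntax; sum-cong-≗; sum-replicate-zero; ∑-distrib-+; ∑-comm;
         *-distribˡ-sum; *-distribʳ-sum)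
open import Data.Product using (∃; _×_; _,_; proj₁; proj₂; map)
open import Data.Sum using (_⊎_; inj₁; inj₂)
open import Function.Base using (_∘_)
open import Function.Bundles using (Inverse; Injection)
open import Function.Properties.Inverse using (↔⇒↣)
open import Relation.Binary.Definitions using (tri<; tri≈; tri>)
open import Relation.Binary.PropositionalEquality
open import Relation.Nullary using (¬_; yes; no; contradiction)

Σℕ≡sum : ∀ n (f : Fin n → ℕ) → Σℕ n f ≡ sum f
Σℕ≡sum zero    f = refl
Σℕ≡sum (suc n) f = cong (λ t → f zero + t) (Σℕ≡sum n (f ∘ suc))

sum-select : ∀ {n} (i : Fin n) (f : Fin n → ℕ) → ∑[ j < n ] (if i == j then f j else 0) ≡ f i
sum-select {suc n} zero    f =
  trans (cong (λ t → f zero + t) (sum-replicate-zero n)) (+-identityʳ (f zero))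
sum-select {suc n} (suc i) f = sum-select i (f ∘ suc)

sum-if-unique : ∀ {n} (p : Fin n → Bool) (i : Fin n) (c : ℕ) →
  p i ≡ true → (∀ j → p j ≡ true → j ≡ i) → ∑[ j < n ] (if p j then c else 0) ≡ c
sum-if-unique p i c pᵢ unique =
  trans (sum-cong-≗ (λ j → cong (λ b → if b then c else 0) (p≡i== j))) (sum-select i (λ _ → c))
  where
  p≡i== : ∀ j → p j ≡ (i == j)
  p≡i== j with i ≟ j
  ... | yes refl = pᵢ
  ... | no i≢j   = Bool.¬-not (λ pⱼ → i≢j (sym (unique j pⱼ)))

sum-if-false : ∀ {n} (p : Fin n → Bool) (f : Fin n → ℕ) → (∀ j → p j ≡ false) →
  ∑[ j < n ] (if p j then f j else 0) ≡ 0
sum-if-false {n} p f never =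
  trans (sum-cong-≗ (λ j → cong (λ b → if b then f j else 0) (never j))) (sum-replicate-zero n)

sum-if-+ : ∀ {n} (p : Fin n → Bool) (f g : Fin n → ℕ) →
  ∑[ j < n ] (if p j then f j + g j else 0) ≡
  ∑[ j < n ] (if p j then f j else 0) + ∑[ j < n ] (if p j then g j else 0)
sum-if-+ p f g =
  trans (sum-cong-≗ (λ j → if-+ (p j)))
        (∑-distrib-+ (λ j → if p j then f j else 0) (λ j → if p j then g j else 0))
  where
  if-+ : ∀ {j} b → (if b then f j + g j else 0) ≡ (if b then f j else 0) + (if b then g j else 0)
  if-+ true  = refl
  if-+ false = refl

sum-if-*ˡ : ∀ {n} (p : Fin n → Bool) (c : ℕ) (f : Fin n → ℕ) →
  ∑[ j < n ] (if p j then c * f j else 0) ≡ c * ∑[ j < n ] (if p j then f j else 0)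
sum-if-*ˡ p c f =
  trans (sum-cong-≗ (λ j → if-* (p j))) (sym (*-distribˡ-sum c (λ j → if p j then f j else 0)))
  where
  if-* : ∀ {j} b → (if b then c * f j else 0) ≡ c * (if b then f j else 0)
  if-* true  = refl
  if-* false = sym (*-zeroʳ c)

sum-if-const : ∀ {n} (p : Fin n → Bool) (c : ℕ) →
  ∑[ j < n ] (if p j then c else 0) ≡ ∑[ j < n ] (if p j then 1 else 0) * c
sum-if-const p c =
  trans (sum-cong-≗ (λ j → if-const (p j))) (sym (*-distribʳ-sum c (λ j → if p j then 1 else 0)))
  where
  if-const : ∀ b → (if b then c else 0) ≡ (if b then 1 else 0) * c
  if-const true  = sym (*-identityˡ c)
  if-const false = refl

count-≤ : ∀ {n} (p : Fin n → Bool) → ∑[ j < n ] (if p j then 1 else 0) ≤ n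
count-≤ {zero}  p = z≤n
count-≤ {suc n} p with p zero
... | true  = s≤s (count-≤ (p ∘ suc))
... | false = m≤n⇒m≤1+n (count-≤ (p ∘ suc))

if-∨ : ∀ a b (c : ℕ) → a ∧ b ≡ false →
  (if a then c else 0) + (if b then c else 0) ≡ (if a ∨ b then c else 0)
if-∨ true  false c _ = +-identityʳ c
if-∨ false b     c _ = refl

==⇒≡ : ∀ {k} {a b : Fin k} → (a == b) ≡ true → a ≡ b
==⇒≡ {a = a} {b} eq with a ≟ b
... | yes a≡b = a≡b

∨-true : ∀ {a b} → a ∨ b ≡ true → a ≡ true ⊎ b ≡ true
∨-true {true}  _  = inj₁ refl
∨-true {false} eq = inj₂ eq

∧-true : ∀ {a b} → a ∧ b ≡ true → a ≡ true × b ≡ true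
∧-true {true} eq = refl , eq

Fin-nontrivial : ∀ {m} → 2 ≤ m → ¬ (∀ (i j : Fin m) → i ≡ j)
Fin-nontrivial (s≤s (s≤s _)) all-equal = contradiction (all-equal zero (suc zero)) λ ()

r*x+r*x≡x+r*c⇒unique : ∀ {r} c {x y} → 0 < r →
  r * x + r * x ≡ x + r * c → r * y + r * y ≡ y + r * c → x ≡ y
r*x+r*x≡x+r*c⇒unique {suc r₀} c {x} {y} _ eqx eqy =
  *-cancelˡ-≡ x y (suc (r₀ + r₀)) (trans (solved eqx) (sym (solved eqy)))
  where
  regroup : ∀ r₀ x → x + suc (r₀ + r₀) * x ≡ suc r₀ * x + suc r₀ * x
  regroup = solve-∀
  solved : ∀ {z} → suc r₀ * z + suc r₀ * z ≡ z + suc r₀ * c →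
           suc (r₀ + r₀) * z ≡ suc r₀ * c
  solved {z} eq = +-cancelˡ-≡ z _ _ (trans (regroup r₀ z) eq)

pos-affine : ∀ r x y → + (x + r * y) ≡ + x ℤ.+ + r ℤ.* + y
pos-affine r x y = trans (ℤ.pos-+ x (r * y)) (cong (λ t → + x ℤ.+ t) (ℤ.pos-* r y))

pos-double : ∀ r x → + (r * x + r * x) ≡ + r ℤ.* + x ℤ.+ + r ℤ.* + x
pos-double r x = trans (ℤ.pos-+ (r * x) (r * x)) (cong₂ ℤ._+_ (ℤ.pos-* r x) (ℤ.pos-* r x))

pos-difference-+ : ∀ w x y z → (+ w - + x) ℤ.+ (+ y - + z) ≡ + (w + y) - + (x + z)
pos-difference-+ w x y z rewrite ℤ.pos-+ w y | ℤ.pos-+ x z = interchange (+ w) (+ x) (+ y) (+ z)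
  where
  interchange : ∀ w x y z → (w - x) ℤ.+ (y - z) ≡ (w ℤ.+ y) - (x ℤ.+ z)
  interchange = ℤ-solve-∀

eigen-algebra : ∀ r d f c → d + r * f ≡ f + r * c →
  + (r * d + r * d) - + (d + r * (r * c)) ≡ (+ 1 - + r) ℤ.* (+ (r * f + r * f) - + (f + r * c))
eigen-algebra r d f c eq = begin
  + (r * d + r * d) - + (d + r * (r * c))
    ≡⟨ cong₂ _-_ (pos-double r d)
                 (trans (pos-affine r d (r * c)) (cong (λ t → D ℤ.+ R ℤ.* t) (ℤ.pos-* r c))) ⟩
  (R ℤ.* D ℤ.+ R ℤ.* D) - (D ℤ.+ R ℤ.* (R ℤ.* C))
    ≡⟨ cong (λ x → (R ℤ.* x ℤ.+ R ℤ.* x) - (x ℤ.+ R ℤ.* (R ℤ.* C))) D≡ ⟩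
  (R ℤ.* D′ ℤ.+ R ℤ.* D′) - (D′ ℤ.+ R ℤ.* (R ℤ.* C))
    ≡⟨ identity R F C ⟩
  (+ 1 - R) ℤ.* ((R ℤ.* F ℤ.+ R ℤ.* F) - (F ℤ.+ R ℤ.* C))
    ≡⟨ cong (λ t → (+ 1 - R) ℤ.* t) (cong₂ _-_ (pos-double r f) (pos-affine r f c)) ⟨
  (+ 1 - + r) ℤ.* (+ (r * f + r * f) - + (f + r * c)) ∎
  where
  open ≡-Reasoning
  R = + r
  D = + d
  F = + f
  C = + c
  D′ = (F ℤ.+ R ℤ.* C) - R ℤ.* F
  isolate : ∀ x y → x ≡ (x ℤ.+ y) - y
  isolate = ℤ-solve-∀
  eqℤ : D ℤ.+ R ℤ.* F ≡ F ℤ.+ R ℤ.* C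
  eqℤ = trans (sym (pos-affine r d f)) (trans (cong +_ eq) (pos-affine r f c))
  D≡ : D ≡ D′
  D≡ = trans (isolate D (R ℤ.* F)) (cong (λ t → t - R ℤ.* F) eqℤ)
  identity : ∀ R F C → let D = (F ℤ.+ R ℤ.* C) - R ℤ.* F in
    (R ℤ.* D ℤ.+ R ℤ.* D) - (D ℤ.+ R ℤ.* (R ℤ.* C)) ≡
    (+ 1 - R) ℤ.* ((R ℤ.* F ℤ.+ R ℤ.* F) - (F ℤ.+ R ℤ.* C))
  identity = ℤ-solve-∀

Σℤ-if-difference : ∀ n (p : Fin n → Bool) (a b : Fin n → ℕ) →
  Σℤ n (λ i → if p i then + a i - + b i else 0ℤ) ≡
  + Σℕ n (λ i → if p i then a i else 0) - + Σℕ n (λ i → if p i then b i else 0)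
Σℤ-if-difference zero    p a b = refl
Σℤ-if-difference (suc n) p a b with p zero | Σℤ-if-difference n (p ∘ suc) (a ∘ suc) (b ∘ suc)
... | true  | ih = trans (cong (λ t → (+ a zero - + b zero) ℤ.+ t) ih) (pos-difference-+ (a zero) (b zero) _ _)
... | false | ih = trans (ℤ.+-identityˡ _) ih

neighbourSum : ∀ {n} → Graph n → (Fin n → ℕ) → Fin n → ℕ
neighbourSum {n} G f u = ∑[ v < n ] (if adj G u v then f v else 0)

-- (2r − 1) f − r c, written without truncated subtraction.
centred : ∀ {n} → ℕ → ℕ → (Fin n → ℕ) → Fin n → ℤ
centred r c f v = + (r * f v + r * f v) - + (f v + r * c)

module RegularGraph {n} (G : Graph n) {r} (regular : Regular G r) where

  neighbourSum-const : ∀ u c → neighbourSum G (λ _ → c) u ≡ r * c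
  neighbourSum-const u c =
    trans (sum-if-const (adj G u) c) (cong (_* c) (trans (sym (Σℕ≡sum n _)) (regular u)))

  centred-eigenvector : ∀ c (f : Fin n → ℕ) →
    (∀ u → neighbourSum G f u + r * f u ≡ f u + r * c) →
    ∀ u → Σℤ n (λ v → if adj G u v then centred r c f v else 0ℤ) ≡
          (+ 1 - + r) ℤ.* centred r c f u
  centred-eigenvector c f eq u = begin
    Σℤ n (λ v → if adj G u v then centred r c f v else 0ℤ)
      ≡⟨ Σℤ-if-difference n (adj G u) (λ v → r * f v + r * f v) (λ v → f v + r * c) ⟩
    + Σℕ n (λ v → if adj G u v then r * f v + r * f v else 0) -
    + Σℕ n (λ v → if adj G u v then f v + r * c else 0)
      ≡⟨ cong₂ (λ a b → + a - + b) doubled shifted ⟩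
    + (r * d + r * d) - + (d + r * (r * c))
      ≡⟨ eigen-algebra r d (f u) c (eq u) ⟩
    (+ 1 - + r) ℤ.* centred r c f u ∎
    where
    open ≡-Reasoning
    d = neighbourSum G f u
    doubled : Σℕ n (λ v → if adj G u v then r * f v + r * f v else 0) ≡ r * d + r * d
    doubled = trans (Σℕ≡sum n _) (trans (sum-if-+ (adj G u) (λ v → r * f v) (λ v → r * f v))
                (cong₂ _+_ (sum-if-*ˡ (adj G u) r f) (sum-if-*ˡ (adj G u) r f)))
    shifted : Σℕ n (λ v → if adj G u v then f v + r * c else 0) ≡ d + r * (r * c)
    shifted = trans (Σℕ≡sum n _) (trans (sum-if-+ (adj G u) f (λ _ → r * c))
                (cong (λ t → d + t) (neighbourSum-const u (r * c))))

centred≡0⇒constant : ∀ {n} r c (f : Fin n → ℕ) → 0 < r →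
  (∀ v → centred r c f v ≡ 0ℤ) → ∀ u v → f u ≡ f v
centred≡0⇒constant r c f 0<r vanishes u v = r*x+r*x≡x+r*c⇒unique c 0<r (solution u) (solution v)
  where
  solution : ∀ v → r * f v + r * f v ≡ f v + r * c
  solution v = ℤ.+-injective (ℤ.i-j≡0⇒i≡j _ _ (vanishes v))

module Incidence {n} (G : Graph n) where

  lo hi : Edge G → Fin n
  lo e = proj₁ (proj₁ e)
  hi e = proj₂ (proj₁ e)

  lo<hi : ∀ e → toℕ (lo e) < toℕ (hi e)
  lo<hi e = proj₁ (proj₂ e)

  lo≢hi : ∀ e → lo e ≢ hi e
  lo≢hi e eq = <-irrefl (cong toℕ eq) (lo<hi e)

  lo≡hi⇒hi≢lo : ∀ e f → lo e ≡ hi f → hi e ≢ lo f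
  lo≡hi⇒hi≢lo e f p q =
    <-asym (lo<hi e) (subst₂ (λ a b → toℕ a < toℕ b) (sym q) (sym p) (lo<hi f))

  Edge-≡ : ∀ {e f : Edge G} → lo e ≡ lo f → hi e ≡ hi f → e ≡ f
  Edge-≡ {_ , a<b , ab} {_ , a<b′ , ab′} refl refl =
    cong₂ (λ p q → _ , p , q) (<-irrelevant a<b a<b′) (Decidable⇒UIP.≡-irrelevant Bool._≟_ ab ab′)

  _∈ₑ_ : Fin n → Edge G → Bool
  u ∈ₑ e = (u == lo e) ∨ (u == hi e)

  other : Fin n → Edge G → Fin n
  other u e = if u == lo e then hi e else lo e

  other-+ : (g : Fin n → ℕ) (u : Fin n) (e : Edge G) → u ∈ₑ e ≡ true →
    g (other u e) + g u ≡ g (lo e) + g (hi e)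
  other-+ g u e u∈e with u ≟ lo e | u ≟ hi e
  ... | yes refl | _        = +-comm (g (hi e)) (g (lo e))
  ... | no _     | yes refl = refl

  ∈ₑ-cases : ∀ u f → u ∈ₑ f ≡ true → u ≡ lo f ⊎ u ≡ hi f
  ∈ₑ-cases u f u∈f with ∨-true u∈f
  ... | inj₁ p = inj₁ (==⇒≡ p)
  ... | inj₂ p = inj₂ (==⇒≡ p)

  endpoints-∈ₑ⇒≡ : ∀ e f → lo e ∈ₑ f ≡ true → hi e ∈ₑ f ≡ true → e ≡ f
  endpoints-∈ₑ⇒≡ e f lo∈f hi∈f with ∈ₑ-cases (lo e) f lo∈f | ∈ₑ-cases (hi e) f hi∈f
  ... | inj₁ p | inj₁ q = ⊥-elim (lo≢hi e (trans p (sym q)))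
  ... | inj₁ p | inj₂ q = Edge-≡ p q
  ... | inj₂ p | inj₁ q = ⊥-elim (lo≡hi⇒hi≢lo e f p q)
  ... | inj₂ p | inj₂ q = ⊥-elim (lo≢hi e (trans p (sym q)))

  lineAdj-distinct : ∀ e f → e ≢ f → lineAdj G e f ≡ (lo e ∈ₑ f) ∨ (hi e ∈ₑ f)
  lineAdj-distinct e f e≢f = begin
    (p₁ ∨ p₂ ∨ p₃ ∨ p₄) ∧ not (p₁ ∧ p₄)
      ≡⟨ cong (λ b → (p₁ ∨ p₂ ∨ p₃ ∨ p₄) ∧ not b) p₁∧p₄≡false ⟩
    (p₁ ∨ p₂ ∨ p₃ ∨ p₄) ∧ true
      ≡⟨ Bool.∧-identityʳ _ ⟩
    p₁ ∨ p₂ ∨ p₃ ∨ p₄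
      ≡⟨ Bool.∨-assoc p₁ p₂ (p₃ ∨ p₄) ⟨
    (p₁ ∨ p₂) ∨ (p₃ ∨ p₄) ∎
    where
    open ≡-Reasoning
    p₁ = lo e == lo f
    p₂ = lo e == hi f
    p₃ = hi e == lo f
    p₄ = hi e == hi f
    p₁∧p₄≡false : p₁ ∧ p₄ ≡ false
    p₁∧p₄≡false = Bool.¬-not λ both → let (l , h) = ∧-true both in e≢f (Edge-≡ (==⇒≡ l) (==⇒≡ h))

  Joins : Edge G → Fin n → Fin n → Bool
  Joins e u v = ((u == lo e) ∧ (hi e == v)) ∨ ((u == hi e) ∧ (lo e == v))

  Joins-cases : ∀ e u v → Joins e u v ≡ true →
    (u ≡ lo e × hi e ≡ v) ⊎ (u ≡ hi e × lo e ≡ v)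
  Joins-cases e u v j with ∨-true j
  ... | inj₁ p = inj₁ (map ==⇒≡ ==⇒≡ (∧-true p))
  ... | inj₂ p = inj₂ (map ==⇒≡ ==⇒≡ (∧-true p))

  Joins-unique : ∀ e f u v → Joins e u v ≡ true → Joins f u v ≡ true → e ≡ f
  Joins-unique e f u v je jf with Joins-cases e u v je | Joins-cases f u v jf
  ... | inj₁ (refl , refl) | inj₁ (p , q) = Edge-≡ p (sym q)
  ... | inj₂ (refl , refl) | inj₂ (p , q) = Edge-≡ (sym q) p
  ... | inj₁ (refl , refl) | inj₂ (p , q) = ⊥-elim (lo≡hi⇒hi≢lo e f p (sym q))
  ... | inj₂ (refl , refl) | inj₁ (p , q) = ⊥-elim (lo≡hi⇒hi≢lo f e (sym p) q)

  Joins⇒adj : ∀ e u v → Joins e u v ≡ true → adj G u v ≡ true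
  Joins⇒adj e u v j with Joins-cases e u v j
  ... | inj₁ (refl , refl) = proj₂ (proj₂ e)
  ... | inj₂ (refl , refl) = trans (symm G (hi e) (lo e)) (proj₂ (proj₂ e))

  Joins-lo-hi : ∀ e → Joins e (lo e) (hi e) ≡ true
  Joins-lo-hi e rewrite ==-refl (lo e) | ==-refl (hi e) = refl

  Joins-hi-lo : ∀ e → Joins e (hi e) (lo e) ≡ true
  Joins-hi-lo e rewrite ==-refl (lo e) | ==-refl (hi e) = Bool.∨-zeroʳ _

  adj⇒∃Joins : ∀ {u v} → adj G u v ≡ true → ∃ λ e → Joins e u v ≡ true
  adj⇒∃Joins {u} {v} uv with <-cmp u v
  ... | tri< u<v _ _  = let e = (u , v) , u<v , uv in e , Joins-lo-hi e
  ... | tri≈ _ refl _ = contradiction (trans (sym uv) (irrefl G u)) λ ()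
  ... | tri> _ _ v<u  = let e = (v , u) , v<u , trans (symm G v u) uv in e , Joins-hi-lo e

  sum-Joins : ∀ e u (F : Fin n → ℕ) →
    ∑[ v < n ] (if Joins e u v then F v else 0) ≡ (if u ∈ₑ e then F (other u e) else 0)
  sum-Joins e u F with u ≟ lo e | u ≟ hi e
  ... | yes refl | yes lo≡hi = ⊥-elim (lo≢hi e lo≡hi)
  ... | yes refl | no _      =
    trans (sum-cong-≗ (λ v → cong (λ b → if b then F v else 0) (Bool.∨-identityʳ (hi e == v))))
          (sum-select (hi e) F)
  ... | no _     | yes refl  = sum-select (lo e) F
  ... | no _     | no _      = sum-replicate-zero n

module EnumeratedEdges {n} (G : Graph n) {m} (enum : Fin m ↔ Edge G) where
  open Incidence G public
  open Inverse enum using (from; strictlyInverseˡ; strictlyInverseʳ)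

  edge : Fin m → Edge G
  edge = Inverse.to enum

  if-adj≡sum-Joins : ∀ u v c →
    (if adj G u v then c else 0) ≡ ∑[ j < m ] (if Joins (edge j) u v then c else 0)
  if-adj≡sum-Joins u v c with adj G u v in uv
  ... | true  = let (e , joins) = adj⇒∃Joins uv in
    sym (sum-if-unique (λ j → Joins (edge j) u v) (from e) c
      (subst (λ f → Joins f u v ≡ true) (sym (strictlyInverseˡ e)) joins)
      (λ j jⱼ → trans (sym (strictlyInverseʳ j)) (cong from (Joins-unique (edge j) e u v jⱼ joins))))
  ... | false = sym (sum-if-false (λ j → Joins (edge j) u v) (λ _ → c)
      (λ j → Bool.¬-not λ jⱼ → contradiction (trans (sym uv) (Joins⇒adj (edge j) u v jⱼ)) λ ()))

  neighbourSum≡incidentSum : ∀ (F : Fin n → ℕ) u →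
    neighbourSum G F u ≡ ∑[ j < m ] (if u ∈ₑ edge j then F (other u (edge j)) else 0)
  neighbourSum≡incidentSum F u = begin
    ∑[ v < n ] (if adj G u v then F v else 0)
      ≡⟨ sum-cong-≗ (λ v → if-adj≡sum-Joins u v (F v)) ⟩
    ∑[ v < n ] ∑[ j < m ] (if Joins (edge j) u v then F v else 0)
      ≡⟨ ∑-comm (λ v j → if Joins (edge j) u v then F v else 0) ⟩
    ∑[ j < m ] ∑[ v < n ] (if Joins (edge j) u v then F v else 0)
      ≡⟨ sum-cong-≗ (λ j → sum-Joins (edge j) u F) ⟩
    ∑[ j < m ] (if u ∈ₑ edge j then F (other u (edge j)) else 0) ∎
    where open ≡-Reasoning

  closedNbhd : Fin m → Fin m → Bool
  closedNbhd i j = (i == j) ∨ lineAdj G (edge i) (edge j)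

  closedNbhd-split : ∀ i j (c : ℕ) →
    (if lo (edge i) ∈ₑ edge j then c else 0) + (if hi (edge i) ∈ₑ edge j then c else 0) ≡
    (if closedNbhd i j then c else 0) + (if i == j then c else 0)
  closedNbhd-split i j c with i ≟ j
  ... | yes refl
    rewrite ==-refl (lo (edge i)) | ==-refl (hi (edge i)) | Bool.∨-zeroʳ (hi (edge i) == lo (edge i)) = refl
  ... | no i≢j = begin
    (if lo (edge i) ∈ₑ edge j then c else 0) + (if hi (edge i) ∈ₑ edge j then c else 0)
      ≡⟨ if-∨ (lo (edge i) ∈ₑ edge j) (hi (edge i) ∈ₑ edge j) c (Bool.¬-not not-both) ⟩
    (if (lo (edge i) ∈ₑ edge j) ∨ (hi (edge i) ∈ₑ edge j) then c else 0)
      ≡⟨ cong (λ b → if b then c else 0) (lineAdj-distinct (edge i) (edge j) edge≢) ⟨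
    (if lineAdj G (edge i) (edge j) then c else 0)
      ≡⟨ +-identityʳ _ ⟨
    (if lineAdj G (edge i) (edge j) then c else 0) + 0 ∎
    where
    open ≡-Reasoning
    edge≢ : edge i ≢ edge j
    edge≢ eq = i≢j (trans (sym (strictlyInverseʳ i)) (trans (cong from eq) (strictlyInverseʳ j)))
    not-both : (lo (edge i) ∈ₑ edge j) ∧ (hi (edge i) ∈ₑ edge j) ≢ true
    not-both both = let (l , h) = ∧-true both in edge≢ (endpoints-∈ₑ⇒≡ (edge i) (edge j) l h)

  weight : (Fin m → ℕ) → Fin n → ℕ
  weight L u = ∑[ j < m ] (if u ∈ₑ edge j then L j else 0)

  weight-endpoints : ∀ (L : Fin m → ℕ) i → weight L (lo (edge i)) + weight L (hi (edge i)) ≡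
    ∑[ j < m ] (if closedNbhd i j then L j else 0) + L i
  weight-endpoints L i = begin
    weight L (lo (edge i)) + weight L (hi (edge i))
      ≡⟨ ∑-distrib-+ (λ j → if lo (edge i) ∈ₑ edge j then L j else 0)
                     (λ j → if hi (edge i) ∈ₑ edge j then L j else 0) ⟨
    ∑[ j < m ] ((if lo (edge i) ∈ₑ edge j then L j else 0) +
                (if hi (edge i) ∈ₑ edge j then L j else 0))
      ≡⟨ sum-cong-≗ (λ j → closedNbhd-split i j (L j)) ⟩
    ∑[ j < m ] ((if closedNbhd i j then L j else 0) + (if i == j then L j else 0))
      ≡⟨ ∑-distrib-+ (λ j → if closedNbhd i j then L j else 0)
                     (λ j → if i == j then L j else 0) ⟩
    ∑[ j < m ] (if closedNbhd i j then L j else 0) + ∑[ j < m ] (if i == j then L j else 0)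
      ≡⟨ cong (λ t → ∑[ j < m ] (if closedNbhd i j then L j else 0) + t) (sum-select i L) ⟩
    ∑[ j < m ] (if closedNbhd i j then L j else 0) + L i ∎
    where open ≡-Reasoning

  MagicAtEndpoints : (Fin m → ℕ) → ℕ → Set
  MagicAtEndpoints L k = ∀ i → weight L (lo (edge i)) + weight L (hi (edge i)) ≡ k + L i

  weight-constant⇒label-constant : ∀ L k → MagicAtEndpoints L k →
    (∀ u v → weight L u ≡ weight L v) → ∀ i j → L i ≡ L j
  weight-constant⇒label-constant L k endpoint-sum constant i j = +-cancelˡ-≡ k (L i) (L j) (begin
    k + L i
      ≡⟨ endpoint-sum i ⟨
    weight L (lo (edge i)) + weight L (hi (edge i))
      ≡⟨ cong₂ _+_ (constant (lo (edge i)) (lo (edge j))) (constant (hi (edge i)) (hi (edge j))) ⟩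
    weight L (lo (edge j)) + weight L (hi (edge j))
      ≡⟨ endpoint-sum j ⟩
    k + L j ∎)
    where open ≡-Reasoning

  module _ {r} (regular : Regular G r) where

    incident-count : ∀ u → ∑[ j < m ] (if u ∈ₑ edge j then 1 else 0) ≡ r
    incident-count u =
      trans (sym (neighbourSum≡incidentSum (λ _ → 1) u)) (trans (sym (Σℕ≡sum n _)) (regular u))

    r≤m : Fin n → r ≤ m
    r≤m u = subst (_≤ m) (incident-count u) (count-≤ (u ∈ₑ_ ∘ edge))

    weight-equation : ∀ L k → MagicAtEndpoints L k →
      ∀ u → neighbourSum G (weight L) u + r * weight L u ≡ weight L u + r * k
    weight-equation L k endpoint-sum u = begin
      neighbourSum G s u + r * s u
        ≡⟨ cong₂ _+_ (neighbourSum≡incidentSum s u) (incident-const (s u)) ⟩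
      ∑[ j < m ] (if u ∈ₑ edge j then s (other u (edge j)) else 0) +
      ∑[ j < m ] (if u ∈ₑ edge j then s u else 0)
        ≡⟨ sum-if-+ (u ∈ₑ_ ∘ edge) (λ j → s (other u (edge j))) (λ _ → s u) ⟨
      ∑[ j < m ] (if u ∈ₑ edge j then s (other u (edge j)) + s u else 0)
        ≡⟨ sum-cong-≗ incident-edge ⟩
      ∑[ j < m ] (if u ∈ₑ edge j then k + L j else 0)
        ≡⟨ sum-if-+ (u ∈ₑ_ ∘ edge) (λ _ → k) L ⟩
      ∑[ j < m ] (if u ∈ₑ edge j then k else 0) + s u
        ≡⟨ +-comm _ (s u) ⟩
      s u + ∑[ j < m ] (if u ∈ₑ edge j then k else 0)
        ≡⟨ cong (λ t → s u + t) (incident-const k) ⟨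
      s u + r * k ∎
      where
      open ≡-Reasoning
      s = weight L
      incident-const : ∀ c → r * c ≡ ∑[ j < m ] (if u ∈ₑ edge j then c else 0)
      incident-const c = sym (trans (sum-if-const (u ∈ₑ_ ∘ edge) c) (cong (_* c) (incident-count u)))
      incident-edge : ∀ j →
        (if u ∈ₑ edge j then s (other u (edge j)) + s u else 0) ≡
        (if u ∈ₑ edge j then k + L j else 0)
      incident-edge j with u ∈ₑ edge j in u∈j
      ... | true  = trans (other-+ s u (edge j) u∈j) (endpoint-sum j)
      ... | false = refl

mainTheorem7 : ∀ {n} (G : Graph n) (r : ℕ) → 0 < n → 1 < r → Regular G r →
    (m : ℕ) (enum : Fin m ↔ Edge G) →
    ClosedDistanceMagic (LineGraph G m enum) →
    IsEigenvalue G (+ 1 - + r)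
mainTheorem7 {n} G r 0<n 1<r regular m enum (π , k , _ , magic) =
  centred r k s , nonzero , centred-eigenvector k s (weight-equation regular label k endpoint-sum)
  where
  open EnumeratedEdges G enum
  open RegularGraph G regular
  label : Fin m → ℕ
  label j = suc (toℕ (Inverse.to π j))
  label-injective : ∀ {i j} → label i ≡ label j → i ≡ j
  label-injective = Injection.injective (↔⇒↣ π) ∘ toℕ-injective ∘ suc-injective
  s : Fin n → ℕ
  s = weight label
  endpoint-sum : MagicAtEndpoints label k
  endpoint-sum i =
    trans (weight-endpoints label i) (cong (_+ label i) (trans (sym (Σℕ≡sum m _)) (magic i)))
  nonzero : ∃ λ v → ¬ centred r k s v ≡ 0ℤ
  nonzero = ¬∀⟶∃¬ n _ (λ v → centred r k s v ℤ.≟ 0ℤ) λ vanishes →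
    let s-constant = centred≡0⇒constant r k s (<-trans z<s 1<r) vanishes in
    Fin-nontrivial (≤-trans 1<r (r≤m regular (fromℕ< 0<n))) λ i j →
      label-injective (weight-constant⇒label-constant label k endpoint-sum s-constant i j)
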